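{- Let $n,h\ge 2$. The Minimax SCC $M$ and the Borda SCC $Bor$ coincide (as functions on $\mathcal{P}$) if and only if $n=2$.
   Context: $N=\{1,\dots,n\}$, $H=\{1,\dots,h\}$, $\mathcal{P}=\mathcal{L}(N)^h$ the set of profiles of linear orders on $N$; $x>_{p_i}y$ means individual $i$ ranks $x$ above $y$; $\mathrm{rank}_q(x)=|\{y:y>_q x\}|+1$. $M(p)=\mathrm{argmin}_{x\in N}\max_{y\ne x}|\{i\in H:y>_{p_i}x\}|$ and $Bor(p)=\mathrm{argmax}_{x\in N}\sum_{i=1}^h(n-\mathrm{rank}_{p_i}(x))$. -}

module Defs where

open import Data.Nat using (ℕ; zero; suc; _+_; _∸_; _≤_; _⊔_)
open import Data.Fin using (Fin; zero; suc; toℕ)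
open import Data.Fin.Properties using (_≟_)
open import Data.Fin.Permutation using (Permutation′; _⟨$⟩ʳ_)
open import Relation.Nullary using (Dec; yes; no; ¬_)
open import Relation.Binary.PropositionalEquality using (_≡_)
import Data.Nat

sumFin : ∀ {k} → (Fin k → ℕ) → ℕ
sumFin {zero}  f = 0
sumFin {suc k} f = f zero + sumFin (λ i → f (suc i))

maxFin : ∀ {k} → (Fin k → ℕ) → ℕ
maxFin {zero}  f = 0
maxFin {suc k} f = f zero ⊔ maxFin (λ i → f (suc i))

count : ∀ {k} {P : Fin k → Set} → ((i : Fin k) → Dec (P i)) → ℕ
count P? = sumFin (λ i → indicator (P? i))
  where
  indicator : ∀ {A : Set} → Dec A → ℕ
  indicator (yes _) = 1
  indicator (no _)  = 0

-- A linear order on N = Fin n, encoded as a bijection assigning to each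
-- alternative its position (0 = top).
LinOrd : ℕ → Set
LinOrd n = Permutation′ n

_>[_]_ : ∀ {n} → Fin n → LinOrd n → Fin n → Set
y >[ q ] x = suc (toℕ (q ⟨$⟩ʳ y)) ≤ toℕ (q ⟨$⟩ʳ x)

gt? : ∀ {n} (y : Fin n) (q : LinOrd n) (x : Fin n) → Dec (y >[ q ] x)
gt? y q x = suc (toℕ (q ⟨$⟩ʳ y)) Data.Nat.≤? toℕ (q ⟨$⟩ʳ x)

Profile : ℕ → ℕ → Set
Profile n h = Fin h → LinOrd n

rank : ∀ {n} → LinOrd n → Fin n → ℕ
rank q x = count (λ y → gt? y q x) + 1

support : ∀ {n h} → Profile n h → Fin n → Fin n → ℕ
support p y x = count (λ i → gt? y (p i) x)

-- max_{y ≠ x} |{i : y >_{p_i} x}|  (the term y = x contributes 0, harmless)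
maxDefeat : ∀ {n h} → Profile n h → Fin n → ℕ
maxDefeat {n} p x = maxFin (λ y → excl y (y ≟ x))
  where
  excl : (y : Fin n) → Dec (y ≡ x) → ℕ
  excl y (yes _) = 0
  excl y (no _)  = support p y x

_∈Minimax_ : ∀ {n h} → Fin n → Profile n h → Set
x ∈Minimax p = ∀ z → maxDefeat p x ≤ maxDefeat p z

bordaScore : ∀ {n h} → Profile n h → Fin n → ℕ
bordaScore {n} p x = sumFin (λ i → n ∸ rank (p i) x)

_∈Borda_ : ∀ {n h} → Fin n → Profile n h → Set
x ∈Borda p = ∀ z → bordaScore p z ≤ bordaScore p x

-- With two alternatives a voter gives x one Borda point exactly when the other
-- alternative is not above x, so the Borda score of x is h minus the support of
-- the opponent against x, which is the maximal defeat of x; hence minimising one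
-- is maximising the other.
--
-- For n ≥ 3 it suffices to break the agreement on three alternatives a, b, c:
-- append the other alternatives below them in a fixed order. Each voter ranks
-- the new ones below a, b, c, so they score less in Borda and are defeated
-- unanimously, while the pairwise supports and Borda comparisons among a, b, c
-- do not change. On three alternatives, adding the pair of
-- voters abc, cba raises every Borda score by 2 and every maximal defeat by 1,
-- so it changes neither rule, and it suffices to break the agreement for
-- h = 2 (profile abc, bca, where a is a Minimax but not a Borda winner) and
-- h = 3 (profile abc, abc, bca, where b is a Borda but not a Minimax winner).
module Submission where

open import Defs
open import Data.Nat
  using (ℕ; zero; suc; _+_; _*_; _∸_; _⊔_; _≤_; _<_; _≤?_; z≤n; s≤s)
open import Data.Nat.Properties
open import Algebra.Properties.CommutativeSemigroup +-commutativeSemigroup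
  using (interchange)
open import Data.Fin using (Fin; zero; suc; toℕ; _↑ˡ_; _↑ʳ_)
open import Data.Fin.Properties using (+↔⊎; splitAt-↑ˡ; toℕ-↑ˡ; toℕ<n; all?)
open import Data.Fin.Permutation
  using (_⟨$⟩ʳ_; id; reverse; transpose; _∘ₚ_)
open import Data.Vec.Functional using ([]; _∷_)
open import Data.Sum.Function.Propositional using (_⊎-↔_)
open import Data.Empty using (⊥-elim)
open import Function using (_∘_)
open import Function.Bundles using (_⇔_; mk⇔; Equivalence)
open import Function.Properties.Inverse using (↔-trans; ↔-sym; ↔-refl)
open import Function.Construct.Composition using (_⇔-∘_)
open import Function.Construct.Symmetry using (⇔-sym)
open import Relation.Nullary using (Dec; yes; no; ¬_)
open import Relation.Nullary.Decidable using (from-yes; from-no)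
open import Relation.Binary.PropositionalEquality
  using (_≡_; refl; sym; trans; cong; cong₂; subst; subst₂; module ≡-Reasoning)

private
  variable
    k h m n : ℕ

Agreement : ℕ → ℕ → Set
Agreement n h = ∀ (p : Profile n h) (x : Fin n) → (x ∈Minimax p) ⇔ (x ∈Borda p)

∀-⇔ : ∀ {A : Set} {P Q : A → Set} → (∀ x → P x ⇔ Q x) → (∀ x → P x) ⇔ (∀ x → Q x)
∀-⇔ P⇔Q = mk⇔ (λ P x → Equivalence.to (P⇔Q x) (P x)) (λ Q x → Equivalence.from (P⇔Q x) (Q x))

≤-shift-⇔ : ∀ {A : Set} {f g : A → ℕ} c → (∀ z → f z ≡ c + g z) →
            ∀ x y → (f x ≤ f y) ⇔ (g x ≤ g y)
≤-shift-⇔ c f≡c+g x y = mk⇔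
  (λ le → +-cancelˡ-≤ c _ _ (subst₂ _≤_ (f≡c+g x) (f≡c+g y) le))
  (λ le → subst₂ _≤_ (sym (f≡c+g x)) (sym (f≡c+g y)) (+-monoʳ-≤ c le))

complement-antitone : ∀ {A : Set} {f g : A → ℕ} {c} → (∀ z → f z + g z ≡ c) →
                      ∀ x y → g x ≤ g y → f y ≤ f x
complement-antitone {f = f} {g} f+g≡c x y le = +-cancelʳ-≤ (g y) (f y) (f x)
  (subst (_≤ f x + g y) (trans (f+g≡c x) (sym (f+g≡c y))) (+-monoʳ-≤ (f x) le))

≤-complement-⇔ : ∀ {A : Set} {f g : A → ℕ} {c} → (∀ z → f z + g z ≡ c) →
                 ∀ x y → (g x ≤ g y) ⇔ (f y ≤ f x)
≤-complement-⇔ {f = f} {g} f+g≡c x y = mk⇔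
  (complement-antitone f+g≡c x y)
  (complement-antitone (λ z → trans (+-comm (g z) (f z)) (f+g≡c z)) y x)

sumFin-cong : ∀ {f g : Fin k → ℕ} → (∀ i → f i ≡ g i) → sumFin f ≡ sumFin g
sumFin-cong {zero}  f≡g = refl
sumFin-cong {suc k} f≡g = cong₂ _+_ (f≡g zero) (sumFin-cong (f≡g ∘ suc))

sumFin-mono : ∀ {f g : Fin k → ℕ} → (∀ i → f i ≤ g i) → sumFin f ≤ sumFin g
sumFin-mono {zero}  f≤g = z≤n
sumFin-mono {suc k} f≤g = +-mono-≤ (f≤g zero) (sumFin-mono (f≤g ∘ suc))

sumFin-+ : ∀ (f g : Fin k → ℕ) → sumFin (λ i → f i + g i) ≡ sumFin f + sumFin g
sumFin-+ {zero}  f g = refl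
sumFin-+ {suc k} f g = begin
  (f zero + g zero) + sumFin (λ i → f (suc i) + g (suc i))
    ≡⟨ cong ((f zero + g zero) +_) (sumFin-+ (f ∘ suc) (g ∘ suc)) ⟩
  (f zero + g zero) + (sumFin (f ∘ suc) + sumFin (g ∘ suc))
    ≡⟨ interchange (f zero) (g zero) _ _ ⟩
  (f zero + sumFin (f ∘ suc)) + (g zero + sumFin (g ∘ suc)) ∎
  where
  open ≡-Reasoning

sumFin-const : ∀ k c → sumFin {k} (λ _ → c) ≡ k * c
sumFin-const zero    c = refl
sumFin-const (suc k) c = cong (c +_) (sumFin-const k c)

sumFin-↑ : ∀ k {m} (f : Fin (k + m) → ℕ) →
           sumFin f ≡ sumFin (λ i → f (i ↑ˡ m)) + sumFin (λ w → f (k ↑ʳ w))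
sumFin-↑ zero    f = refl
sumFin-↑ (suc k) f = trans (cong (f zero +_) (sumFin-↑ k (f ∘ suc))) (sym (+-assoc (f zero) _ _))

maxFin-zero : ∀ {f : Fin k → ℕ} → (∀ i → f i ≡ 0) → maxFin f ≡ 0
maxFin-zero {zero}  f≡0 = refl
maxFin-zero {suc k} f≡0 = cong₂ _⊔_ (f≡0 zero) (maxFin-zero (f≡0 ∘ suc))

-- count in Defs sums a local copy of this indicator, which cannot be named.
indicator : ∀ {A : Set} → Dec A → ℕ
indicator (yes _) = 1
indicator (no _)  = 0

count-as-sum : ∀ {k} {P : Fin k → Set} (P? : ∀ i → Dec (P i)) →
               count P? ≡ sumFin (λ i → indicator (P? i))
count-as-sum {zero}  P? = refl
count-as-sum {suc k} P? with P? zero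
... | yes _ = cong suc (count-as-sum (P? ∘ suc))
... | no _  = count-as-sum (P? ∘ suc)

count-zero : ∀ {k} {P : Fin k → Set} (P? : ∀ i → Dec (P i)) → (∀ i → ¬ P i) → count P? ≡ 0
count-zero {zero}  P? ¬P = refl
count-zero {suc k} P? ¬P with P? zero
... | yes p = ⊥-elim (¬P zero p)
... | no _  = count-zero (P? ∘ suc) (¬P ∘ suc)

count-all : ∀ {k} {P : Fin k → Set} (P? : ∀ i → Dec (P i)) → (∀ i → P i) → count P? ≡ k
count-all {zero}  P? allP = refl
count-all {suc k} P? allP with P? zero
... | yes _ = cong suc (count-all (P? ∘ suc) (allP ∘ suc))
... | no ¬p = ⊥-elim (¬p (allP zero))

count-≤ : ∀ {k} {P : Fin k → Set} (P? : ∀ i → Dec (P i)) → count P? ≤ k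
count-≤ {zero}  P? = z≤n
count-≤ {suc k} P? with P? zero
... | yes _ = s≤s (count-≤ (P? ∘ suc))
... | no _  = m≤n⇒m≤1+n (count-≤ (P? ∘ suc))

count-< : ∀ {k} {P : Fin k → Set} (P? : ∀ i → Dec (P i)) → ∀ x → ¬ P x → count P? < k
count-< {suc k} P? x ¬Px with P? zero | x
... | yes p | zero  = ⊥-elim (¬Px p)
... | yes _ | suc x = s≤s (count-< (P? ∘ suc) x ¬Px)
... | no _  | zero  = s≤s (count-≤ (P? ∘ suc))
... | no _  | suc x = m<n⇒m<1+n (count-< (P? ∘ suc) x ¬Px)

count-mono : ∀ {k} {P Q : Fin k → Set} (P? : ∀ i → Dec (P i)) (Q? : ∀ i → Dec (Q i)) →
             (∀ i → P i → Q i) → count P? ≤ count Q?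
count-mono {zero}  P? Q? P⇒Q = z≤n
count-mono {suc k} P? Q? P⇒Q with P? zero | Q? zero
... | yes _ | yes _  = s≤s (count-mono (P? ∘ suc) (Q? ∘ suc) (P⇒Q ∘ suc))
... | yes p | no ¬q = ⊥-elim (¬q (P⇒Q zero p))
... | no _  | yes _  = m≤n⇒m≤1+n (count-mono (P? ∘ suc) (Q? ∘ suc) (P⇒Q ∘ suc))
... | no _  | no _   = count-mono (P? ∘ suc) (Q? ∘ suc) (P⇒Q ∘ suc)

count-cong : ∀ {k} {P Q : Fin k → Set} (P? : ∀ i → Dec (P i)) (Q? : ∀ i → Dec (Q i)) →
             (∀ i → P i ⇔ Q i) → count P? ≡ count Q?
count-cong P? Q? P⇔Q = ≤-antisym
  (count-mono P? Q? (Equivalence.to ∘ P⇔Q))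
  (count-mono Q? P? (Equivalence.from ∘ P⇔Q))

count-↑ : ∀ k {m} {P : Fin (k + m) → Set} (P? : ∀ i → Dec (P i)) →
          count P? ≡ count (λ i → P? (i ↑ˡ m)) + count (λ w → P? (k ↑ʳ w))
count-↑ k P? = sumFin-↑ k _

>-irrefl : ∀ (q : LinOrd n) x → ¬ (x >[ q ] x)
>-irrefl q x = n≮n _

rank-≤ : ∀ (q : LinOrd n) x → rank q x ≤ n
rank-≤ {n} q x = subst (_≤ n) (+-comm 1 _) (count-< (λ y → gt? y q x) x (>-irrefl q x))

other : Fin 2 → Fin 2
other zero       = suc zero
other (suc zero) = zero

borda-point-2 : ∀ (q : LinOrd 2) x → (2 ∸ rank q x) + indicator (gt? (other x) q x) ≡ 1
borda-point-2 q zero with gt? zero q zero | gt? (suc zero) q zero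
... | yes x>x | _     = ⊥-elim (>-irrefl q zero x>x)
... | no _    | yes _ = refl
... | no _    | no _  = refl
borda-point-2 q (suc zero) with gt? zero q (suc zero) | gt? (suc zero) q (suc zero)
... | _     | yes x>x = ⊥-elim (>-irrefl q (suc zero) x>x)
... | yes _ | no _    = refl
... | no _  | no _    = refl

maxDefeat-2 : ∀ (p : Profile 2 h) x → maxDefeat p x ≡ support p (other x) x
maxDefeat-2 p zero       = ⊔-identityʳ _
maxDefeat-2 p (suc zero) = ⊔-identityʳ _

borda+maxDefeat-2 : ∀ (p : Profile 2 h) x → bordaScore p x + maxDefeat p x ≡ h
borda+maxDefeat-2 {h} p x = begin
  bordaScore p x + maxDefeat p x
    ≡⟨ cong (bordaScore p x +_)
            (trans (maxDefeat-2 p x) (count-as-sum (λ i → gt? (other x) (p i) x))) ⟩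
  sumFin (λ i → 2 ∸ rank (p i) x) + sumFin (λ i → indicator (gt? (other x) (p i) x))
    ≡⟨ sym (sumFin-+ (λ i → 2 ∸ rank (p i) x) (λ i → indicator (gt? (other x) (p i) x))) ⟩
  sumFin (λ i → (2 ∸ rank (p i) x) + indicator (gt? (other x) (p i) x))
    ≡⟨ sumFin-cong (λ i → borda-point-2 (p i) x) ⟩
  sumFin {h} (λ _ → 1)
    ≡⟨ trans (sumFin-const h 1) (*-identityʳ h) ⟩
  h ∎
  where open ≡-Reasoning

minimax⇔borda-2 : Agreement 2 h
minimax⇔borda-2 p x = ∀-⇔ (≤-complement-⇔ {f = bordaScore p} (borda+maxDefeat-2 p) x)

abc cba bca : LinOrd 3
abc = id
cba = reverse
bca = transpose zero (suc (suc zero)) ∘ₚ transpose zero (suc zero)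

addReversedPair : Profile 3 h → Profile 3 (2 + h)
addReversedPair p = abc ∷ cba ∷ p

bordaScore-addReversedPair : ∀ (p : Profile 3 h) x →
                             bordaScore (addReversedPair p) x ≡ 2 + bordaScore p x
bordaScore-addReversedPair p zero             = refl
bordaScore-addReversedPair p (suc zero)       = refl
bordaScore-addReversedPair p (suc (suc zero)) = refl

suc-⊔-suc : ∀ a b → suc a ⊔ (suc b ⊔ 0) ≡ suc (a ⊔ (b ⊔ 0))
suc-⊔-suc a b = cong (λ t → suc (a ⊔ t)) (sym (⊔-identityʳ b))

maxDefeat-addReversedPair : ∀ (p : Profile 3 h) x →
                            maxDefeat (addReversedPair p) x ≡ 1 + maxDefeat p x
maxDefeat-addReversedPair p zero             =
  suc-⊔-suc (support p (suc zero) zero) (support p (suc (suc zero)) zero)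
maxDefeat-addReversedPair p (suc zero)       =
  suc-⊔-suc (support p zero (suc zero)) (support p (suc (suc zero)) (suc zero))
maxDefeat-addReversedPair p (suc (suc zero)) =
  suc-⊔-suc (support p zero (suc (suc zero))) (support p (suc zero) (suc (suc zero)))

minimax-addReversedPair : ∀ (p : Profile 3 h) x →
                          (x ∈Minimax addReversedPair p) ⇔ (x ∈Minimax p)
minimax-addReversedPair p x = ∀-⇔ (≤-shift-⇔ 1 (maxDefeat-addReversedPair p) x)

borda-addReversedPair : ∀ (p : Profile 3 h) x →
                        (x ∈Borda addReversedPair p) ⇔ (x ∈Borda p)
borda-addReversedPair p x = ∀-⇔ λ z → ≤-shift-⇔ 2 (bordaScore-addReversedPair p) z x

agreement-removeReversedPair : Agreement 3 (2 + h) → Agreement 3 h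
agreement-removeReversedPair agree p x =
  borda-addReversedPair p x
    ⇔-∘ (agree (addReversedPair p) x ⇔-∘ ⇔-sym (minimax-addReversedPair p x))

minimax? : ∀ (p : Profile n h) x → Dec (x ∈Minimax p)
minimax? p x = all? (λ z → maxDefeat p x ≤? maxDefeat p z)

borda? : ∀ (p : Profile n h) x → Dec (x ∈Borda p)
borda? p x = all? (λ z → bordaScore p z ≤? bordaScore p x)

no-agreement-3 : ∀ k → ¬ Agreement 3 (2 + k)
no-agreement-3 zero agree =
  from-no (borda? p a) (Equivalence.to (agree p a) (from-yes (minimax? p a)))
  where
  p : Profile 3 2
  p = abc ∷ bca ∷ []
  a : Fin 3
  a = zero
no-agreement-3 (suc zero) agree =
  from-no (minimax? p b) (Equivalence.from (agree p b) (from-yes (borda? p b)))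
  where
  p : Profile 3 3
  p = abc ∷ abc ∷ bca ∷ []
  b : Fin 3
  b = suc zero
no-agreement-3 (suc (suc k)) agree = no-agreement-3 k (agreement-removeReversedPair agree)

maxDefeat-≤ : ∀ (p : Profile 3 h) x → maxDefeat p x ≤ h
maxDefeat-≤ p zero             = ⊔-lub (count-≤ _) (⊔-lub (count-≤ _) z≤n)
maxDefeat-≤ p (suc zero)       = ⊔-lub (count-≤ _) (⊔-lub (count-≤ _) z≤n)
maxDefeat-≤ p (suc (suc zero)) = ⊔-lub (count-≤ _) (⊔-lub (count-≤ _) z≤n)

module BottomExtension (m : ℕ) where

  -- σ on the alternatives i ↑ˡ m, the alternatives 3 ↑ʳ w kept in place below them
  extend : LinOrd 3 → LinOrd (3 + m)
  extend σ = ↔-trans +↔⊎ (↔-trans (σ ⊎-↔ ↔-refl) (↔-sym +↔⊎))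

  special-or-tail : ∀ {Q : Fin (3 + m) → Set} →
                    (∀ i → Q (i ↑ˡ m)) → (∀ w → Q (3 ↑ʳ w)) → ∀ z → Q z
  special-or-tail special tail zero                = special zero
  special-or-tail special tail (suc zero)          = special (suc zero)
  special-or-tail special tail (suc (suc zero))    = special (suc (suc zero))
  special-or-tail special tail (suc (suc (suc w))) = tail w

  position-special : ∀ σ i → toℕ (extend σ ⟨$⟩ʳ (i ↑ˡ m)) ≡ toℕ (σ ⟨$⟩ʳ i)
  position-special σ i rewrite splitAt-↑ˡ 3 i m = toℕ-↑ˡ (σ ⟨$⟩ʳ i) m

  position-special<3 : ∀ σ i → toℕ (extend σ ⟨$⟩ʳ (i ↑ˡ m)) < 3
  position-special<3 σ i = subst (_< 3) (sym (position-special σ i)) (toℕ<n (σ ⟨$⟩ʳ i))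

  >-special⇔ : ∀ σ i j → ((j ↑ˡ m) >[ extend σ ] (i ↑ˡ m)) ⇔ (j >[ σ ] i)
  >-special⇔ σ i j = mk⇔
    (subst₂ (λ a b → suc a ≤ b) (position-special σ j) (position-special σ i))
    (subst₂ (λ a b → suc a ≤ b) (sym (position-special σ j)) (sym (position-special σ i)))

  special>tail : ∀ σ i w → (i ↑ˡ m) >[ extend σ ] (3 ↑ʳ w)
  special>tail σ i w = ≤-trans (position-special<3 σ i) (m≤m+n 3 (toℕ w))

  tail≯special : ∀ σ i w → ¬ ((3 ↑ʳ w) >[ extend σ ] (i ↑ˡ m))
  tail≯special σ i w tail>i = <⇒≱ (position-special<3 σ i) (≤-trans (m≤m+n 3 (toℕ w)) (<⇒≤ tail>i))

  rank-special : ∀ σ i → rank (extend σ) (i ↑ˡ m) ≡ rank σ i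
  rank-special σ i = cong (_+ 1) (begin
    count (λ y → gt? y (extend σ) (i ↑ˡ m))
      ≡⟨ count-↑ 3 (λ y → gt? y (extend σ) (i ↑ˡ m)) ⟩
    count (λ j → gt? (j ↑ˡ m) (extend σ) (i ↑ˡ m)) + count (λ w → gt? (3 ↑ʳ w) (extend σ) (i ↑ˡ m))
      ≡⟨ cong₂ _+_
           (count-cong (λ j → gt? (j ↑ˡ m) (extend σ) (i ↑ˡ m)) (λ j → gt? j σ i) (>-special⇔ σ i))
           (count-zero (λ w → gt? (3 ↑ʳ w) (extend σ) (i ↑ˡ m)) (tail≯special σ i)) ⟩
    count (λ j → gt? j σ i) + 0
      ≡⟨ +-identityʳ _ ⟩
    count (λ j → gt? j σ i) ∎)
    where open ≡-Reasoning

  rank-special≤tail : ∀ σ i w → rank (extend σ) (i ↑ˡ m) ≤ rank (extend σ) (3 ↑ʳ w)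
  rank-special≤tail σ i w = +-monoˡ-≤ 1 (count-mono
    (λ y → gt? y (extend σ) (i ↑ˡ m)) (λ y → gt? y (extend σ) (3 ↑ʳ w))
    (λ y y>i → ≤-trans y>i (<⇒≤ (special>tail σ i w))))

  extendProfile : Profile 3 h → Profile (3 + m) h
  extendProfile p = extend ∘ p

  borda-points-special : ∀ σ i → (3 + m) ∸ rank (extend σ) (i ↑ˡ m) ≡ (3 ∸ rank σ i) + m
  borda-points-special σ i = trans (cong ((3 + m) ∸_) (rank-special σ i)) (+-∸-comm m (rank-≤ σ i))

  bordaScore-special : ∀ (p : Profile 3 h) i →
                       bordaScore (extendProfile p) (i ↑ˡ m) ≡ h * m + bordaScore p i
  bordaScore-special {h} p i = begin
    sumFin (λ v → (3 + m) ∸ rank (extend (p v)) (i ↑ˡ m))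
      ≡⟨ sumFin-cong (λ v → borda-points-special (p v) i) ⟩
    sumFin (λ v → (3 ∸ rank (p v) i) + m)
      ≡⟨ sumFin-+ (λ v → 3 ∸ rank (p v) i) (λ _ → m) ⟩
    bordaScore p i + sumFin {h} (λ _ → m)
      ≡⟨ cong (bordaScore p i +_) (sumFin-const h m) ⟩
    bordaScore p i + h * m
      ≡⟨ +-comm (bordaScore p i) (h * m) ⟩
    h * m + bordaScore p i ∎
    where open ≡-Reasoning

  bordaScore-tail≤special : ∀ (p : Profile 3 h) i w →
    bordaScore (extendProfile p) (3 ↑ʳ w) ≤ bordaScore (extendProfile p) (i ↑ˡ m)
  bordaScore-tail≤special p i w =
    sumFin-mono (λ v → ∸-monoʳ-≤ (3 + m) (rank-special≤tail (p v) i w))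

  support-special : ∀ (p : Profile 3 h) i j →
                    support (extendProfile p) (j ↑ˡ m) (i ↑ˡ m) ≡ support p j i
  support-special p i j =
    count-cong (λ v → gt? (j ↑ˡ m) (extend (p v)) (i ↑ˡ m)) (λ v → gt? j (p v) i)
               (λ v → >-special⇔ (p v) i j)

  support-tail-special : ∀ (p : Profile 3 h) i →
                         maxFin (λ w → support (extendProfile p) (3 ↑ʳ w) (i ↑ˡ m)) ≡ 0
  support-tail-special p i = maxFin-zero λ w →
    count-zero (λ v → gt? (3 ↑ʳ w) (extend (p v)) (i ↑ˡ m)) (λ v → tail≯special (p v) i w)

  maxDefeat-special : ∀ (p : Profile 3 h) i → maxDefeat (extendProfile p) (i ↑ˡ m) ≡ maxDefeat p i
  maxDefeat-special p zero             = cong₂ _⊔_ (support-special p zero (suc zero))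
    (cong₂ _⊔_ (support-special p zero (suc (suc zero))) (support-tail-special p zero))
  maxDefeat-special p (suc zero)       = cong₂ _⊔_ (support-special p (suc zero) zero)
    (cong₂ _⊔_ (support-special p (suc zero) (suc (suc zero))) (support-tail-special p (suc zero)))
  maxDefeat-special p (suc (suc zero)) = cong₂ _⊔_ (support-special p (suc (suc zero)) zero)
    (cong₂ _⊔_ (support-special p (suc (suc zero)) (suc zero))
               (support-tail-special p (suc (suc zero))))

  h≤maxDefeat-tail : ∀ (p : Profile 3 h) w → h ≤ maxDefeat (extendProfile p) (3 ↑ʳ w)
  h≤maxDefeat-tail p w = ≤-trans
    (≤-reflexive (sym (count-all (λ v → gt? zero (extend (p v)) (3 ↑ʳ w))
                                 (λ v → special>tail (p v) zero w))))
    (m≤m⊔n _ _)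

  minimax-extend : ∀ (p : Profile 3 h) i → ((i ↑ˡ m) ∈Minimax extendProfile p) ⇔ (i ∈Minimax p)
  minimax-extend {h} p i = mk⇔
    (λ i↑-min z → subst₂ _≤_ (maxDefeat-special p i) (maxDefeat-special p z) (i↑-min (z ↑ˡ m)))
    (λ i-min → special-or-tail
      (λ z → subst₂ _≤_ (sym (maxDefeat-special p i)) (sym (maxDefeat-special p z)) (i-min z))
      (λ w → begin
        maxDefeat (extendProfile p) (i ↑ˡ m) ≡⟨ maxDefeat-special p i ⟩
        maxDefeat p i                        ≤⟨ maxDefeat-≤ p i ⟩
        h                                    ≤⟨ h≤maxDefeat-tail p w ⟩
        maxDefeat (extendProfile p) (3 ↑ʳ w) ∎))
    where open ≤-Reasoning

  borda-extend : ∀ (p : Profile 3 h) i → ((i ↑ˡ m) ∈Borda extendProfile p) ⇔ (i ∈Borda p)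
  borda-extend {h} p i = mk⇔
    (λ i↑-max z → Equivalence.to (shifted z) (i↑-max (z ↑ˡ m)))
    (λ i-max → special-or-tail
      (λ z → Equivalence.from (shifted z) (i-max z))
      (bordaScore-tail≤special p i))
    where
    shifted : ∀ z → (bordaScore (extendProfile p) (z ↑ˡ m) ≤ bordaScore (extendProfile p) (i ↑ˡ m))
                  ⇔ (bordaScore p z ≤ bordaScore p i)
    shifted z = ≤-shift-⇔ (h * m) (bordaScore-special p) z i

  agreement-restricts : Agreement (3 + m) h → Agreement 3 h
  agreement-restricts agree p i =
    borda-extend p i ⇔-∘ (agree (extendProfile p) (i ↑ˡ m) ⇔-∘ ⇔-sym (minimax-extend p i))

corollary4 : (n h : ℕ) → 2 ≤ n → 2 ≤ h →
    ((∀ (p : Profile n h) (x : Fin n) → (x ∈Minimax p) ⇔ (x ∈Borda p)) ⇔ (n ≡ 2))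
corollary4 0                   h             ()       _
corollary4 1                   h             (s≤s ()) _
corollary4 2                   h             _        _ =
  mk⇔ (λ _ → refl) (λ _ → minimax⇔borda-2)
corollary4 (suc (suc (suc m))) 0             _        ()
corollary4 (suc (suc (suc m))) 1             _        (s≤s ())
corollary4 (suc (suc (suc m))) (suc (suc k)) _        _ =
  mk⇔ (λ agree → ⊥-elim (no-agreement-3 k (BottomExtension.agreement-restricts m agree))) (λ ())
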